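{- Let $G$ be a connected graph and let $G'$ be the graph obtained from $G$ by adding a new vertex adjacent to every vertex of $G$. Then $\chi_{NL}(G')=\chi_{NL}(G)+1$.
   Context: A $k$-coloring of a graph $G$ is a partition of $V(G)$ into $k$ independent sets (colors). A coloring $\{S_1,\dots,S_k\}$ is neighbor-locating (an NL-coloring) if for any two distinct vertices $u,v$ in the same color class, $\{j: N(u)\cap S_j\neq\emptyset\}\neq\{j: N(v)\cap S_j\neq\emptyset\}$. The neighbor-locating chromatic number $\chi_{NL}(G)$ is the minimum number of colors in an NL-coloring of $G$. -}

module Defs where

open import Data.Nat using (ℕ; suc; _<_)
open import Data.Fin using (Fin; zero; suc)
open import Data.Product using (Σ; _×_; ∃)
open import Data.Empty using (⊥)
open import Data.Unit using (⊤)
open import Relation.Nullary using (¬_)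
open import Relation.Binary.PropositionalEquality using (_≡_; _≢_)
open import Function.Bundles using (_⇔_)

record Graph (n : ℕ) : Set₁ where
  field
    Adj   : Fin n → Fin n → Set
    sym   : ∀ {u v} → Adj u v → Adj v u
    irrefl : ∀ {u} → ¬ Adj u u
open Graph public

data Walk {n : ℕ} (G : Graph n) : Fin n → Fin n → Set where
  here : ∀ {u} → Walk G u u
  step : ∀ {u v w} → Adj G u v → Walk G v w → Walk G u w

Connected : ∀ {n} → Graph n → Set
Connected {n} G = ∀ (u v : Fin n) → Walk G u v

-- G' : add a new vertex (zero) adjacent to every vertex of G.
JoinAdj : ∀ {n} → Graph n → Fin (suc n) → Fin (suc n) → Set
JoinAdj G zero    zero    = ⊥
JoinAdj G zero    (suc _) = ⊤
JoinAdj G (suc _) zero    = ⊤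
JoinAdj G (suc i) (suc j) = Adj G i j

join-sym : ∀ {n} (G : Graph n) {u v : Fin (suc n)} → JoinAdj G u v → JoinAdj G v u
join-sym G {zero}  {zero}  ()
join-sym G {zero}  {suc _} t = t
join-sym G {suc _} {zero}  t = t
join-sym G {suc i} {suc j} a = sym G a

join-irrefl : ∀ {n} (G : Graph n) {u : Fin (suc n)} → ¬ JoinAdj G u u
join-irrefl G {zero}  ()
join-irrefl G {suc i} a = irrefl G a

addUniversal : ∀ {n} → Graph n → Graph (suc n)
addUniversal G = record
  { Adj = JoinAdj G ; sym = λ {u} {v} → join-sym G {u} {v} ; irrefl = λ {u} → join-irrefl G {u} }

ProperColoring : ∀ {n} → Graph n → (k : ℕ) → (Fin n → Fin k) → Set
ProperColoring G k c = ∀ {u v} → Adj G u v → c u ≢ c v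

SeesColor : ∀ {n k} → Graph n → (Fin n → Fin k) → Fin n → Fin k → Set
SeesColor G c u j = ∃ λ w → Adj G u w × c w ≡ j

NeighborLocating : ∀ {n} → Graph n → (k : ℕ) → (Fin n → Fin k) → Set
NeighborLocating {n} G k c =
  ∀ (u v : Fin n) → u ≢ v → c u ≡ c v →
    ¬ (∀ (j : Fin k) → SeesColor G c u j ⇔ SeesColor G c v j)

NLColoring : ∀ {n} → Graph n → (k : ℕ) → (Fin n → Fin k) → Set
NLColoring G k c = ProperColoring G k c × NeighborLocating G k c

HasNLColoring : ∀ {n} → Graph n → ℕ → Set
HasNLColoring {n} G k = Σ (Fin n → Fin k) (NLColoring G k)

IsChiNL : ∀ {n} → Graph n → ℕ → Set
IsChiNL G k = HasNLColoring G k × (∀ m → m < k → ¬ HasNLColoring G m)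

module Submission where

-- Let G' = G + apex.  The apex is adjacent to every other vertex, so in any proper
-- colouring of G' its colour is used by no other vertex, and every vertex of G sees it.
--
--  * Extension (χ_NL(G') ≤ χ_NL(G) + 1): give the apex a fresh colour 0 and shift the
--    colours of an NL-colouring of G by one.  A vertex of G sees colour (suc j) in G'
--    exactly when it sees j in G, so equal colour sets in G' give equal ones in G.
--  * Restriction (χ_NL(G) ≤ χ_NL(G') - 1): from an NL-colouring of G' with suc m colours,
--    delete the apex colour p with 'punchOut'.  For j ≢ p, seeing j in G' is the same
--    as seeing the punched-out colour in G, and colour p is seen by every vertex of G;
--    hence equal colour sets in G give equal ones in G'.
--
-- The theorem combines both with the minimality of k.

open import Defs
open import Data.Nat using (ℕ; suc; zero; _<_; s≤s)
open import Data.Fin using (Fin; zero; suc; punchOut; _≟_)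
open import Data.Fin.Properties using (punchOut-injective; punchOut-cong; suc-injective)
open import Data.Product using (_,_; proj₁; proj₂)
open import Data.Empty using (⊥-elim)
open import Data.Unit using (tt)
open import Relation.Nullary using (¬_; yes; no)
open import Relation.Binary.PropositionalEquality using (_≡_; _≢_; refl; cong)
open import Function using (const)
open import Function.Bundles using (_⇔_; mk⇔)
import Function.Properties.Equivalence as ⇔

SameNeighbourColours : ∀ {n k} → Graph n → (Fin n → Fin k) → Fin n → Fin n → Set
SameNeighbourColours G c u v = ∀ j → SeesColor G c u j ⇔ SeesColor G c v j

module Extension {n k : ℕ} (G : Graph n) (c : Fin n → Fin k) (nl : NLColoring G k c) where

  c⁺ : Fin (suc n) → Fin (suc k)
  c⁺ zero    = zero
  c⁺ (suc i) = suc (c i)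

  proper : ProperColoring (addUniversal G) (suc k) c⁺
  proper {zero}  {zero}  ()
  proper {zero}  {suc v} _ ()
  proper {suc u} {zero}  _ ()
  proper {suc u} {suc v} a e = proj₁ nl a (suc-injective e)

  -- A vertex of G sees a shifted colour in G' iff it sees the colour in G
  -- (the apex carries colour 0, so it never witnesses a shifted colour).
  sees-shifted : ∀ u j → SeesColor (addUniversal G) c⁺ (suc u) (suc j) ⇔ SeesColor G c u j
  sees-shifted u j = mk⇔ to from
    where
    to : SeesColor (addUniversal G) c⁺ (suc u) (suc j) → SeesColor G c u j
    to (zero  , _ , ())
    to (suc y , a , e) = y , a , suc-injective e
    from : SeesColor G c u j → SeesColor (addUniversal G) c⁺ (suc u) (suc j)
    from (x , a , e) = suc x , a , cong suc e

  same-in-G : ∀ {u v} → SameNeighbourColours (addUniversal G) c⁺ (suc u) (suc v) →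
              SameNeighbourColours G c u v
  same-in-G {u} {v} same j =
    ⇔.trans (⇔.sym (sees-shifted u j)) (⇔.trans (same (suc j)) (sees-shifted v j))

  -- The apex is the only vertex of colour 0, so only pairs of old vertices need checking.
  locating : NeighborLocating (addUniversal G) (suc k) c⁺
  locating zero    zero    u≢v _  _    = u≢v refl
  locating zero    (suc v) _   () _
  locating (suc u) zero    _   () _
  locating (suc u) (suc v) u≢v e  same =
    proj₂ nl u v (λ u≡v → u≢v (cong suc u≡v)) (suc-injective e) (same-in-G same)

  extend : HasNLColoring (addUniversal G) (suc k)
  extend = c⁺ , proper , locating

module Restriction {n m : ℕ} (G : Graph n) (c : Fin (suc n) → Fin (suc m))
                   (nl : NLColoring (addUniversal G) (suc m) c) where

  apex-colour : Fin (suc m)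
  apex-colour = c zero

  -- Every vertex of G is adjacent to the apex, hence coloured differently.
  apex-colour-unique : ∀ x → apex-colour ≢ c (suc x)
  apex-colour-unique x = proj₁ nl {zero} {suc x} tt

  d : Fin n → Fin m
  d x = punchOut (apex-colour-unique x)

  d-reflects-equality : ∀ {u v} → d u ≡ d v → c (suc u) ≡ c (suc v)
  d-reflects-equality {u} {v} = punchOut-injective (apex-colour-unique u) (apex-colour-unique v)

  proper : ProperColoring G m d
  proper {u} {v} a e = proj₁ nl {suc u} {suc v} a (d-reflects-equality e)

  sees-punchedOut : ∀ u {j} (p≢j : apex-colour ≢ j) →
                    SeesColor (addUniversal G) c (suc u) j ⇔ SeesColor G d u (punchOut p≢j)
  sees-punchedOut u {j} p≢j = mk⇔ to from
    where
    to : SeesColor (addUniversal G) c (suc u) j → SeesColor G d u (punchOut p≢j)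
    to (zero  , _ , p≡j) = ⊥-elim (p≢j p≡j)
    to (suc x , a , e)   = x , a , punchOut-cong apex-colour e
    from : SeesColor G d u (punchOut p≢j) → SeesColor (addUniversal G) c (suc u) j
    from (y , b , e) = suc y , b , punchOut-injective (apex-colour-unique y) p≢j e

  sees-apex-colour : ∀ u {j} → apex-colour ≡ j → SeesColor (addUniversal G) c (suc u) j
  sees-apex-colour u p≡j = zero , tt , p≡j

  same-in-G' : ∀ {u v} → SameNeighbourColours G d u v →
               SameNeighbourColours (addUniversal G) c (suc u) (suc v)
  same-in-G' {u} {v} same j with apex-colour ≟ j
  ... | yes p≡j = mk⇔ (const (sees-apex-colour v p≡j)) (const (sees-apex-colour u p≡j))
  ... | no  p≢j = ⇔.trans (sees-punchedOut u p≢j)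
                    (⇔.trans (same (punchOut p≢j)) (⇔.sym (sees-punchedOut v p≢j)))

  locating : NeighborLocating G m d
  locating u v u≢v e same =
    proj₂ nl (suc u) (suc v) (λ u≡v → u≢v (suc-injective u≡v)) (d-reflects-equality e)
      (same-in-G' same)

  restrict : HasNLColoring G m
  restrict = d , proper , locating

no-colouring-with-zero-colours : ∀ {n} (H : Graph (suc n)) → ¬ HasNLColoring H 0
no-colouring-with-zero-colours H (c , _) with c zero
... | ()

lemma18 : ∀ (n : ℕ) (G : Graph n) → Connected G → ∀ (k : ℕ) →
    IsChiNL G k → IsChiNL (addUniversal G) (suc k)
lemma18 n G _ k ((c , nl) , minimal) = Extension.extend G c nl , no-fewer
  where
  no-fewer : ∀ m → m < suc k → ¬ HasNLColoring (addUniversal G) m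
  no-fewer zero    _         = no-colouring-with-zero-colours (addUniversal G)
  no-fewer (suc m) (s≤s m<k) (c' , nl') = minimal m m<k (Restriction.restrict G c' nl')
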